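{- Fix an even integer $d\ge 4$. Let $G$ be a simple graph on $c$ vertices and $n$ edges such that (1) $G$ is Eulerian, i.e., connected with every vertex of even degree, and (2) $G$ contains no cycle $C_j$ as a subgraph for any $j$ with $3\le j\le d/2$ and $j\ne d/2-1$. Then there is a CF-coloring of $\mathsf{FC}_d(n)$ with $c$ colors.
   Context: A conflict-free coloring (CF-coloring) of a hypergraph $(V,\mathcal{E})$ is a map $\varphi$ on $V$ such that every nonempty hyperedge $e$ contains a vertex $x$ with $\varphi(y)\ne\varphi(x)$ for all $y\in e\setminus\{x\}$. $\mathsf{FC}_d(n)$ is the $d$-uniform hypergraph on $[n]$ whose hyperedges are the vertex sets of facets of the cyclic polytope $\mathrm{conv}\{\gamma_d(1),\dots,\gamma_d(n)\}$, $\gamma_d(t)=(t,\dots,t^d)$, with $\gamma_d(i)$ identified with $i$; equivalently, a $d$-subset $S\subseteq[n]$ is a hyperedge iff for all $i,j\in[n]\setminus S$ the set $\{k\in S:i<k<j\}$ has even size. -}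

module Defs where

open import Data.Nat using (ℕ; zero; suc; _+_; _*_; _≤_; _<_)
open import Data.Nat.DivMod using (_mod_)
open import Data.Fin using (Fin; toℕ)
open import Data.Fin.Subset using (Subset; _∈_; _∉_; ∣_∣; Nonempty)
open import Data.Bool using (Bool; true; false; if_then_else_)
open import Data.Vec using (lookup)
open import Data.Product using (Σ; ∃; _×_; _,_; proj₁; proj₂)
open import Data.Sum using (_⊎_)
open import Data.Empty using (⊥)
open import Relation.Nullary using (¬_; does)
open import Relation.Binary.PropositionalEquality using (_≡_; _≢_)
open import Function.Definitions using (Injective)
open import Data.Fin using () renaming (_<?_ to _<ᶠ?_; _<_ to _<ᶠ_)
open import Data.Bool using (_∧_)

Even : ℕ → Set
Even m = ∃ λ k → m ≡ 2 * k

count : ∀ {n} → (Fin n → Bool) → ℕ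
count {zero}  p = 0
count {suc n} p = (if p Fin.zero then 1 else 0) + count {n} (λ i → p (Fin.suc i))

record SimpleGraph (c n : ℕ) : Set where
  field
    edge       : Fin n → Fin c × Fin c
    edge-ord   : ∀ i → proj₁ (edge i) <ᶠ proj₂ (edge i)
    edge-inj   : Injective _≡_ _≡_ edge

module _ {c n : ℕ} (G : SimpleGraph c n) where
  open SimpleGraph G

  Adj : Fin c → Fin c → Set
  Adj u v = ∃ λ i → (edge i ≡ (u , v)) ⊎ (edge i ≡ (v , u))

  incident : Fin c → Fin n → Bool
  incident v i = does (proj₁ (edge i) Data.Fin.≟ v) Data.Bool.∨ does (proj₂ (edge i) Data.Fin.≟ v)

  degree : Fin c → ℕ
  degree v = count (incident v)

  data Reach : Fin c → Fin c → Set where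
    here  : ∀ {u} → Reach u u
    step  : ∀ {u w v} → Adj u w → Reach w v → Reach u v

  Connected : Set
  Connected = ∀ u v → Reach u v

  Eulerian : Set
  Eulerian = Connected × (∀ v → Even (degree v))

  ContainsCycle : ℕ → Set
  ContainsCycle zero    = ⊥
  ContainsCycle (suc m) =
    Σ (Fin (suc m) → Fin c) λ f →
      Injective _≡_ _≡_ f × (∀ i → Adj (f i) (f ((suc (toℕ i)) mod (suc m))))

-- The hypergraph FC_d(n) on vertex set Fin n (vertex k ↔ k+1 ∈ [n]):
-- a subset S is a hyperedge iff |S| = d and for all i, j ∉ S the number of
-- k ∈ S with i < k < j is even.

inS : ∀ {n} → Subset n → Fin n → Bool
inS S k = lookup S k

between : ∀ {n} → Subset n → Fin n → Fin n → ℕ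
between S i j = count (λ k → inS S k ∧ does (i <ᶠ? k) ∧ does (k <ᶠ? j))

IsFCEdge : (d n : ℕ) → Subset n → Set
IsFCEdge d n S = (∣ S ∣ ≡ d) × (∀ i j → i ∉ S → j ∉ S → Even (between S i j))

IsCFColoring : ∀ {C : Set} (d n : ℕ) → (Fin n → C) → Set
IsCFColoring d n φ =
  ∀ (S : Subset n) → IsFCEdge d n S → Nonempty S →
    ∃ λ x → x ∈ S × (∀ y → y ∈ S → y ≢ x → φ y ≢ φ x)

module Submission where

-- Write d = 2m and colour the vertex i of FC_d(n) by the i-th vertex of an Euler circuit of G, so that
-- the pair {i, i+1} (cyclically) is coloured by the two ends of the i-th edge of the circuit.  By Gale's
-- evenness condition a facet S is the disjoint union of m such cyclically consecutive pairs, hence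
-- corresponds to a set of m distinct edges of G.  If no colour occurred exactly once in S, every end of
-- one of these edges would also be an end of another one, i.e. they would span a subgraph of minimum
-- degree two.  Walking in it until a vertex repeats gives a cycle of length j with 3 ≤ j ≤ m; if
-- j = m - 1, the one remaining edge is a chord of that cycle and cuts off a cycle of length at most m - 2.
-- Either way G contains a forbidden cycle.

open import Defs

open import Data.Bool using (Bool; true; false; _∧_; _∨_; not; if_then_else_)
open import Data.Bool.Properties
  using (∧-zeroʳ; ∧-identityʳ; ∨-zeroʳ; ∨-comm; ¬-not) renaming (_≟_ to _≟ᵇ_)
open import Data.Empty using (⊥-elim)
open import Data.Fin as F using (Fin; toℕ)
import Data.Fin.Properties as FP
open import Data.Fin.Subset using (Subset; ∣_∣; Nonempty) renaming (_∈_ to _∈ₛ_; _∉_ to _∉ₛ_)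
open import Data.Fin.Subset.Properties using () renaming (_∈?_ to _∈ₛ?_)
open import Data.List using (List; []; _∷_; _++_; length; map; filter; allFin; lookup)
open import Data.List.Membership.Propositional using (_∈_; _∉_)
open import Data.List.Membership.Propositional.Properties
  using (∈-filter⁺; ∈-allFin; ∈-map⁺; ∈-lookup; ∈-++⁺ˡ; ∈-++⁻; ∈-∃++)
open import Data.List.Properties using (length-map; length-++; ++-assoc)
open import Data.List.Relation.Binary.Disjoint.Propositional using (Disjoint)
open import Data.List.Relation.Binary.Permutation.Propositional.Properties using (∈-resp-↭; ++-comm)
open import Data.List.Relation.Unary.All as All using (All; []; _∷_)
import Data.List.Relation.Unary.All.Properties as Allₚ
open import Data.List.Relation.Unary.Any as Any using (here; there)
open import Data.List.Relation.Unary.Linked as Linked using (Linked; []; [-]; _∷_)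
open import Data.List.Relation.Unary.Unique.Propositional using (Unique; []; _∷_)
import Data.List.Relation.Unary.Unique.Propositional.Properties as Uniqueₚ
import Data.Nat as ℕ
open import Data.Nat using (ℕ; zero; suc; _+_; _*_; _≤_; _<_; z≤n; s≤s; _<ᵇ_; ⌊_/2⌋; parity)
open import Data.Nat.DivMod using (_mod_; m<n⇒m%n≡m; n%n≡0)
open import Data.Nat.Properties
open import Algebra.Properties.CommutativeSemigroup +-commutativeSemigroup
  using (interchange; x∙yz≈y∙xz)
open import Data.Parity.Base as ℙ using (Parity; 0ℙ; 1ℙ; _⁻¹)
import Data.Parity.Properties as ℙₚ
open import Data.Parity.Properties using (p+p≡0ℙ; p≢p⁻¹; +-homo-+; *-homo-*; ⁻¹-involutive; ⁻¹-injective)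
open import Data.Product using (∃; ∃₂; _×_; _,_; proj₁; proj₂)
open import Data.Sum using (_⊎_; inj₁; inj₂)
open import Data.Vec as V using (Vec; []; _∷_)
import Data.Vec.Properties as VP
open import Function using (_∘_)
open import Relation.Binary.Definitions using (tri<; tri≈; tri>)
open import Relation.Binary.PropositionalEquality
  using (_≡_; _≢_; refl; sym; trans; cong; cong₂; subst; subst₂; module ≡-Reasoning)
open import Relation.Nullary using (¬_; Dec; yes; no; does; contradiction)
open import Relation.Nullary.Decidable using (dec-true; dec-false; ¬?; _×-dec_)

from-does : ∀ {A : Set} (a? : Dec A) → does a? ≡ true → A
from-does (yes a) _ = a

from-not-does : ∀ {A : Set} (a? : Dec A) → not (does a?) ≡ true → ¬ A
from-not-does (no ¬a) _ = ¬a

∧-true : ∀ {a b} → a ∧ b ≡ true → a ≡ true × b ≡ true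
∧-true {true} {true} _ = refl , refl

indicator : Bool → ℕ
indicator b = if b then 1 else 0

infix 5 _∈ᵇ_
_∈ᵇ_ : ∀ {n} → Fin n → List (Fin n) → Bool
x ∈ᵇ []       = false
x ∈ᵇ (y ∷ ys) = does (x F.≟ y) ∨ (x ∈ᵇ ys)

∈ᵇ⇒∈ : ∀ {n} {x : Fin n} ℓ → x ∈ᵇ ℓ ≡ true → x ∈ ℓ
∈ᵇ⇒∈ {x = x} (y ∷ ys) e with x F.≟ y
... | yes x≡y = here x≡y
... | no _    = there (∈ᵇ⇒∈ ys e)

∈⇒∈ᵇ : ∀ {n} {x : Fin n} {ℓ} → x ∈ ℓ → x ∈ᵇ ℓ ≡ true
∈⇒∈ᵇ {x = x} {y ∷ ys} (here x≡y) = cong (_∨ (x ∈ᵇ ys)) (dec-true (x F.≟ y) x≡y)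
∈⇒∈ᵇ {x = x} {y ∷ ys} (there x∈) = trans (cong (does (x F.≟ y) ∨_) (∈⇒∈ᵇ x∈)) (∨-zeroʳ _)

∉⇒∈ᵇ : ∀ {n} {x : Fin n} ℓ → x ∉ ℓ → x ∈ᵇ ℓ ≡ false
∉⇒∈ᵇ {x = x} ℓ x∉ with x ∈ᵇ ℓ in e
... | true  = contradiction (∈ᵇ⇒∈ ℓ e) x∉
... | false = refl

∈ᵇ≡false⇒∉ : ∀ {n} {x : Fin n} {ℓ} → x ∈ᵇ ℓ ≡ false → x ∉ ℓ
∈ᵇ≡false⇒∉ e x∈ with () ← trans (sym e) (∈⇒∈ᵇ x∈)

countList : ∀ {n} → (Fin n → Bool) → List (Fin n) → ℕ
countList p []       = 0
countList p (x ∷ xs) = indicator (p x) + countList p xs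

countList-++ : ∀ {n} (p : Fin n → Bool) xs ys → countList p (xs ++ ys) ≡ countList p xs + countList p ys
countList-++ p []       ys = refl
countList-++ p (x ∷ xs) ys =
  trans (cong (indicator (p x) +_) (countList-++ p xs ys)) (sym (+-assoc (indicator (p x)) _ _))

count-cong : ∀ {n} {p q : Fin n → Bool} → (∀ i → p i ≡ q i) → count p ≡ count q
count-cong {zero}  e = refl
count-cong {suc n} e = cong₂ _+_ (cong indicator (e F.zero)) (count-cong (λ i → e (F.suc i)))

count-none : ∀ {n} (p : Fin n → Bool) → (∀ i → p i ≡ false) → count p ≡ 0
count-none {zero}  p e = refl
count-none {suc n} p e rewrite e F.zero = count-none (λ i → p (F.suc i)) (λ i → e (F.suc i))

count-all : ∀ n → count {n} (λ _ → true) ≡ n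
count-all zero    = refl
count-all (suc n) = cong suc (count-all n)

count-split : ∀ {n} (p q : Fin n → Bool) →
  count p ≡ count (λ i → p i ∧ q i) + count (λ i → p i ∧ not (q i))
count-split {zero} p q = refl
count-split {suc n} p q = begin
    indicator (p₀) + count p₊
      ≡⟨ cong₂ _+_ (split₀ p₀ (q F.zero)) (count-split p₊ q₊) ⟩
    (indicator (p₀ ∧ q F.zero) + indicator (p₀ ∧ not (q F.zero)))
      + (count (λ i → p₊ i ∧ q₊ i) + count (λ i → p₊ i ∧ not (q₊ i)))
      ≡⟨ interchange (indicator (p₀ ∧ q F.zero)) _ _ _ ⟩
    (indicator (p₀ ∧ q F.zero) + count (λ i → p₊ i ∧ q₊ i))
      + (indicator (p₀ ∧ not (q F.zero)) + count (λ i → p₊ i ∧ not (q₊ i))) ∎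
  where
  open ≡-Reasoning
  p₀ : Bool
  p₀ = p F.zero
  p₊ q₊ : Fin n → Bool
  p₊ i = p (F.suc i)
  q₊ i = q (F.suc i)
  split₀ : ∀ a b → indicator a ≡ indicator (a ∧ b) + indicator (a ∧ not b)
  split₀ false b     = refl
  split₀ true  false = refl
  split₀ true  true  = refl

count-∧-≟ : ∀ {n} (p : Fin n → Bool) (h : Fin n) →
  count (λ i → p i ∧ does (i F.≟ h)) ≡ indicator (p h)
count-∧-≟ {suc n} p F.zero =
  trans (cong₂ _+_ (cong indicator (∧-identityʳ (p F.zero))) (count-none _ (λ i → ∧-zeroʳ (p (F.suc i)))))
        (+-identityʳ _)
count-∧-≟ {suc n} p (F.suc h) =
  trans (cong (_+ count (λ i → p (F.suc i) ∧ does (i F.≟ h))) (cong indicator (∧-zeroʳ (p F.zero))))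
        (count-∧-≟ (λ i → p (F.suc i)) h)

count-∧-∈ᵇ : ∀ {n} (p : Fin n → Bool) ℓ → Unique ℓ →
  count (λ i → p i ∧ (i ∈ᵇ ℓ)) ≡ countList p ℓ
count-∧-∈ᵇ p [] [] = count-none _ (λ i → ∧-zeroʳ (p i))
count-∧-∈ᵇ p (y ∷ ys) u@(_ ∷ u′) = begin
    count (λ i → p i ∧ (i ∈ᵇ (y ∷ ys)))
      ≡⟨ count-split _ (λ i → does (i F.≟ y)) ⟩
    count (λ i → (p i ∧ (i ∈ᵇ (y ∷ ys))) ∧ does (i F.≟ y))
      + count (λ i → (p i ∧ (i ∈ᵇ (y ∷ ys))) ∧ not (does (i F.≟ y)))
      ≡⟨ cong₂ _+_ (count-cong at-y) (count-cong off-y) ⟩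
    count (λ i → p i ∧ does (i F.≟ y)) + count (λ i → p i ∧ (i ∈ᵇ ys))
      ≡⟨ cong₂ _+_ (count-∧-≟ p y) (count-∧-∈ᵇ p ys u′) ⟩
    indicator (p y) + countList p ys ∎
  where
  open ≡-Reasoning
  at-y : ∀ i → (p i ∧ (i ∈ᵇ (y ∷ ys))) ∧ does (i F.≟ y) ≡ p i ∧ does (i F.≟ y)
  at-y i with i F.≟ y
  ... | yes _ = ∧-identityʳ _
  ... | no _  = trans (∧-zeroʳ _) (sym (∧-zeroʳ _))
  off-y : ∀ i → (p i ∧ (i ∈ᵇ (y ∷ ys))) ∧ not (does (i F.≟ y)) ≡ p i ∧ (i ∈ᵇ ys)
  off-y i with i F.≟ y
  ... | yes refl = trans (∧-zeroʳ _) (sym (trans (cong (p i ∧_) (∉⇒∈ᵇ ys y∉ys)) (∧-zeroʳ (p i))))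
    where
    y∉ys : y ∉ ys
    y∉ys = Uniqueₚ.Unique[x∷xs]⇒x∉xs u
  ... | no _     = ∧-identityʳ _

countList-all : ∀ {n} (p : Fin n → Bool) ℓ → All (λ x → p x ≡ true) ℓ → countList p ℓ ≡ length ℓ
countList-all p []       []         = refl
countList-all p (y ∷ ys) (py ∷ pys) rewrite py = cong suc (countList-all p ys pys)

count-unique : ∀ {n} (p : Fin n → Bool) ℓ → Unique ℓ → All (λ x → p x ≡ true) ℓ →
  count p ≡ length ℓ + count (λ i → p i ∧ not (i ∈ᵇ ℓ))
count-unique p ℓ u pℓ =
  trans (count-split p (_∈ᵇ ℓ))
        (cong (_+ count (λ i → p i ∧ not (i ∈ᵇ ℓ))) (trans (count-∧-∈ᵇ p ℓ u) (countList-all p ℓ pℓ)))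

length≤count : ∀ {n} (p : Fin n → Bool) ℓ → Unique ℓ → All (λ x → p x ≡ true) ℓ → length ℓ ≤ count p
length≤count p ℓ u pℓ = subst (length ℓ ≤_) (sym (count-unique p ℓ u pℓ)) (m≤m+n _ _)

unique-length≤ : ∀ {n} (ℓ : List (Fin n)) → Unique ℓ → length ℓ ≤ n
unique-length≤ {n} ℓ u =
  subst (length ℓ ≤_) (count-all n) (length≤count (λ _ → true) ℓ u (All.tabulate (λ _ → refl)))

count≡0⇒false : ∀ {n} (p : Fin n → Bool) → count p ≡ 0 → ∀ i → p i ≡ false
count≡0⇒false {suc n} p e F.zero with p F.zero
... | false = refl
count≡0⇒false {suc n} p e (F.suc i) with p F.zero
... | false = count≡0⇒false (λ j → p (F.suc j)) e i

count≡1⇒ : ∀ {n} (p : Fin n → Bool) → count p ≡ 1 →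
  ∃ λ q → p q ≡ true × (∀ y → p y ≡ true → y ≡ q)
count≡1⇒ {suc n} p e with p F.zero in p₀
... | true  = F.zero , p₀ , only-zero
  where
  only-zero : ∀ y → p y ≡ true → y ≡ F.zero
  only-zero F.zero    _  = refl
  only-zero (F.suc y) py with () ← trans (sym py) (count≡0⇒false _ (suc-injective e) y)
... | false with count≡1⇒ (λ j → p (F.suc j)) e
...   | q , pq , only-q = F.suc q , pq , only-suc-q
  where
  only-suc-q : ∀ y → p y ≡ true → y ≡ F.suc q
  only-suc-q F.zero    py with () ← trans (sym p₀) py
  only-suc-q (F.suc y) py = cong F.suc (only-q y py)

count≡length : ∀ {n} (p : Fin n → Bool) ℓ → Unique ℓ → All (λ x → p x ≡ true) ℓ →
  (∀ x → p x ≡ true → x ∈ ℓ) → count p ≡ length ℓ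
count≡length p ℓ u pℓ cover =
  trans (count-unique p ℓ u pℓ) (trans (cong (length ℓ +_) (count-none _ outside)) (+-identityʳ _))
  where
  outside : ∀ i → p i ∧ not (i ∈ᵇ ℓ) ≡ false
  outside i with p i in pi
  ... | false = refl
  ... | true  rewrite ∈⇒∈ᵇ (cover i pi) = refl

count≡suc-length : ∀ {n} (p : Fin n → Bool) ℓ → Unique ℓ → All (λ x → p x ≡ true) ℓ →
  count p ≡ suc (length ℓ) →
  ∃ λ q → p q ≡ true × q ∉ ℓ × (∀ y → p y ≡ true → y ≢ q → y ∈ ℓ)
count≡suc-length p ℓ u pℓ e with count≡1⇒ (λ i → p i ∧ not (i ∈ᵇ ℓ)) one-outside
  where
  one-outside : count (λ i → p i ∧ not (i ∈ᵇ ℓ)) ≡ 1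
  one-outside =
    +-cancelˡ-≡ (length ℓ) _ 1 (trans (sym (count-unique p ℓ u pℓ)) (trans e (+-comm 1 (length ℓ))))
... | q , pq , only-q = q , proj₁ (∧-true pq) , q∉ℓ , inside
  where
  q∉ℓ : q ∉ ℓ
  q∉ℓ q∈ℓ with () ← trans (sym (proj₂ (∧-true pq))) (cong not (∈⇒∈ᵇ q∈ℓ))
  inside : ∀ y → p y ≡ true → y ≢ q → y ∈ ℓ
  inside y py y≢q with y ∈ᵇ ℓ in e
  ... | true  = ∈ᵇ⇒∈ ℓ e
  ... | false = contradiction (only-q y (cong₂ _∧_ py (cong not e))) y≢q

members : ∀ {n} → (Fin n → Bool) → List (Fin n)
members {n} p = filter (λ i → p i ≟ᵇ true) (allFin n)

members-unique : ∀ {n} (p : Fin n → Bool) → Unique (members p)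
members-unique {n} p = Uniqueₚ.filter⁺ _ (Uniqueₚ.allFin⁺ n)

members-sound : ∀ {n} (p : Fin n → Bool) → All (λ x → p x ≡ true) (members p)
members-sound {n} p = Allₚ.all-filter _ (allFin n)

members-complete : ∀ {n} (p : Fin n → Bool) x → p x ≡ true → x ∈ members p
members-complete p x px = ∈-filter⁺ _ (∈-allFin x) px

count-bijection : ∀ {n} (p q : Fin n → Bool) (f : Fin n → Fin n) → (∀ {x y} → f x ≡ f y → x ≡ y) →
  (∀ x → p x ≡ true → q (f x) ≡ true) → (∀ y → q y ≡ true → ∃ λ x → p x ≡ true × f x ≡ y) →
  count p ≡ count q
count-bijection p q f f-injective p⇒q q⇒p = begin
  count p                    ≡⟨ count≡length p _ (members-unique p) (members-sound p) (members-complete p) ⟩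
  length (members p)         ≡⟨ length-map f (members p) ⟨
  length (map f (members p)) ≡⟨ count≡length q _ image-unique image-sound image-complete ⟨
  count q                    ∎
  where
  open ≡-Reasoning
  image-unique : Unique (map f (members p))
  image-unique = Uniqueₚ.map⁺ f-injective (members-unique p)
  image-sound : All (λ y → q y ≡ true) (map f (members p))
  image-sound = Allₚ.map⁺ (All.map (λ {x} → p⇒q x) (members-sound p))
  image-complete : ∀ y → q y ≡ true → y ∈ map f (members p)
  image-complete y qy with q⇒p y qy
  ... | x , px , refl = ∈-map⁺ f (members-complete p x px)

∉⇒Unique-∷ : ∀ {A : Set} {x : A} {xs} → x ∉ xs → Unique xs → Unique (x ∷ xs)
∉⇒Unique-∷ x∉ u = Allₚ.¬Any⇒All¬ _ x∉ ∷ u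

∉⇒length< : ∀ {n} {ℓ : List (Fin n)} {x} → Unique ℓ → x ∉ ℓ → length ℓ < n
∉⇒length< u x∉ = unique-length≤ _ (∉⇒Unique-∷ x∉ u)

Unique-++⁻ˡ : ∀ {A : Set} (xs : List A) {ys} → Unique (xs ++ ys) → Unique xs
Unique-++⁻ˡ []       _          = []
Unique-++⁻ˡ (x ∷ xs) (x∉ ∷ u) = Allₚ.++⁻ˡ xs x∉ ∷ Unique-++⁻ˡ xs u

Unique-++⁻ʳ : ∀ {A : Set} (xs : List A) {ys} → Unique (xs ++ ys) → Unique ys
Unique-++⁻ʳ []       u       = u
Unique-++⁻ʳ (x ∷ xs) (_ ∷ u) = Unique-++⁻ʳ xs u

Unique-++⁻-disjoint : ∀ {A : Set} (xs : List A) {ys} → Unique (xs ++ ys) → Disjoint xs ys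
Unique-++⁻-disjoint (x ∷ xs) (x∉ ∷ u) (here refl , z∈ys) = All.lookup (Allₚ.++⁻ʳ xs x∉) z∈ys refl
Unique-++⁻-disjoint (x ∷ xs) (_ ∷ u)  (there z∈xs , z∈ys) = Unique-++⁻-disjoint xs u (z∈xs , z∈ys)

Unique-++-comm : ∀ {A : Set} (xs : List A) {ys} → Unique (xs ++ ys) → Unique (ys ++ xs)
Unique-++-comm xs u = Uniqueₚ.++⁺ (Unique-++⁻ʳ xs u) (Unique-++⁻ˡ xs u)
                                  (λ (z∈ys , z∈xs) → Unique-++⁻-disjoint xs u (z∈xs , z∈ys))

lookup-injective : ∀ {A : Set} {xs : List A} → Unique xs → ∀ {i j} → lookup xs i ≡ lookup xs j → i ≡ j
lookup-injective {xs = _ ∷ _} u {F.zero}  {F.zero}  _ = refl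
lookup-injective (x∉ ∷ u) {F.zero}  {F.suc j} e = contradiction e (All.lookup x∉ (∈-lookup j))
lookup-injective (x∉ ∷ u) {F.suc i} {F.zero}  e = contradiction (sym e) (All.lookup x∉ (∈-lookup i))
lookup-injective (_ ∷ u)  {F.suc i} {F.suc j} e = cong F.suc (lookup-injective u e)

Linked-++⁻ˡ : ∀ {A : Set} {R : A → A → Set} xs {ys} → Linked R (xs ++ ys) → Linked R xs
Linked-++⁻ˡ []           _       = []
Linked-++⁻ˡ (x ∷ [])     _       = [-]
Linked-++⁻ˡ (x ∷ y ∷ xs) (r ∷ l) = r ∷ Linked-++⁻ˡ (y ∷ xs) l

Linked-++⁻ʳ : ∀ {A : Set} {R : A → A → Set} xs {ys} → Linked R (xs ++ ys) → Linked R ys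
Linked-++⁻ʳ []       l = l
Linked-++⁻ʳ (x ∷ xs) l = Linked-++⁻ʳ xs (Linked.tail l)

Linked-snoc : ∀ {A : Set} {R : A → A → Set} xs {y z} → Linked R (xs ++ y ∷ []) → R y z →
  Linked R ((xs ++ y ∷ []) ++ z ∷ [])
Linked-snoc []           [-]      r = r ∷ [-]
Linked-snoc (x ∷ [])     (r′ ∷ l) r = r′ ∷ Linked-snoc [] l r
Linked-snoc (x ∷ y ∷ xs) (r′ ∷ l) r = r′ ∷ Linked-snoc (y ∷ xs) l r

Linked-lookup : ∀ {A : Set} {R : A → A → Set} {xs} → Linked R xs →
  ∀ i j → toℕ j ≡ suc (toℕ i) → R (lookup xs i) (lookup xs j)
Linked-lookup (r ∷ _) F.zero    (F.suc F.zero) _ = r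
Linked-lookup (_ ∷ l) (F.suc i) (F.suc j)      e = Linked-lookup l i j (suc-injective e)
Linked-lookup [-]     F.zero    (F.suc ())     _
Linked-lookup (_ ∷ _) F.zero    F.zero         ()
Linked-lookup (_ ∷ _) F.zero    (F.suc (F.suc _)) ()
Linked-lookup (_ ∷ _) (F.suc _) F.zero         ()

lookup-++ˡ : ∀ {A : Set} (xs : List A) {ys} (i : Fin (length (xs ++ ys))) (j : Fin (length xs)) →
  toℕ i ≡ toℕ j → lookup (xs ++ ys) i ≡ lookup xs j
lookup-++ˡ (x ∷ xs) F.zero    F.zero    _ = refl
lookup-++ˡ (x ∷ xs) (F.suc i) (F.suc j) e = lookup-++ˡ xs i j (suc-injective e)

lookup-++-length : ∀ {A : Set} (xs : List A) {y ys} (i : Fin (length (xs ++ y ∷ ys))) →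
  toℕ i ≡ length xs → lookup (xs ++ y ∷ ys) i ≡ y
lookup-++-length []       F.zero    _ = refl
lookup-++-length (x ∷ xs) (F.suc i) e = lookup-++-length xs i (suc-injective e)

toParity : Bool → Parity
toParity false = 0ℙ
toParity true  = 1ℙ

≢⇒≡⁻¹ : ∀ {p q : Parity} → p ≢ q → p ≡ q ⁻¹
≢⇒≡⁻¹ {0ℙ} {0ℙ} p≢q = contradiction refl p≢q
≢⇒≡⁻¹ {0ℙ} {1ℙ} _   = refl
≢⇒≡⁻¹ {1ℙ} {0ℙ} _   = refl
≢⇒≡⁻¹ {1ℙ} {1ℙ} p≢q = contradiction refl p≢q

parity-indicator : ∀ b → parity (indicator b) ≡ toParity b
parity-indicator false = refl
parity-indicator true  = refl

parity-even : ∀ {m} → Even m → parity m ≡ 0ℙ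
parity-even (k , refl) = *-homo-* 2 k

toParity-∨ : ∀ a b t → a ∧ b ≡ false → toParity (a ∨ b) ℙ.+ (toParity b ℙ.+ t) ≡ toParity a ℙ.+ t
toParity-∨ false false t _ = refl
toParity-∨ false true  t _ = ⁻¹-involutive t
toParity-∨ true  false t _ = refl

next : ∀ {k} → Fin k → Fin k
next {suc k} i = suc (toℕ i) mod suc k

last-or-below : ∀ {k} (i : Fin (suc k)) → toℕ i < k ⊎ toℕ i ≡ k
last-or-below i = m≤n⇒m<n∨m≡n (FP.toℕ≤pred[n] i)

toℕ-next-below : ∀ {k} (i : Fin (suc k)) → toℕ i < k → toℕ (next i) ≡ suc (toℕ i)
toℕ-next-below i i<k = trans (FP.toℕ-fromℕ< _) (m<n⇒m%n≡m (s≤s i<k))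

toℕ-next-last : ∀ {k} (i : Fin (suc k)) → toℕ i ≡ k → toℕ (next i) ≡ 0
toℕ-next-last {k} i i≡k rewrite i≡k = trans (FP.toℕ-fromℕ< _) (n%n≡0 (suc k))

InPair : ∀ {k} → Fin k → Fin k → Set
InPair x y = y ≡ x ⊎ y ≡ next x

prev : ∀ {k} → Fin (suc k) → Fin (suc k)
prev {k} F.zero    = F.fromℕ k
prev     (F.suc y) = F.inject₁ y

next-prev : ∀ {k} (y : Fin (suc k)) → next (prev y) ≡ y
next-prev {k} F.zero    = FP.toℕ-injective (toℕ-next-last (F.fromℕ k) (FP.toℕ-fromℕ k))
next-prev     (F.suc y) =
  FP.toℕ-injective (trans (toℕ-next-below (F.inject₁ y) below) (cong suc (FP.toℕ-inject₁ y)))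
  where
  below : toℕ (F.inject₁ y) < _
  below = subst (_< _) (sym (FP.toℕ-inject₁ y)) (FP.toℕ<n y)

next-injective : ∀ {k} {x y : Fin (suc k)} → next x ≡ next y → x ≡ y
next-injective {x = x} {y} e with last-or-below x | last-or-below y
... | inj₁ x< | inj₁ y< =
  FP.toℕ-injective (suc-injective (trans (sym (toℕ-next-below x x<)) (trans (cong toℕ e) (toℕ-next-below y y<))))
... | inj₁ x< | inj₂ y= with () ← trans (sym (toℕ-next-below x x<)) (trans (cong toℕ e) (toℕ-next-last y y=))
... | inj₂ x= | inj₁ y< with () ← trans (sym (toℕ-next-last x x=)) (trans (cong toℕ e) (toℕ-next-below y y<))
... | inj₂ x= | inj₂ y= = FP.toℕ-injective (trans x= (sym y=))

-- Trails and Euler circuits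

module Graph {c n : ℕ} (G : SimpleGraph c n) where
  open SimpleGraph G

  Joins : Fin n → Fin c → Fin c → Set
  Joins e u w = edge e ≡ (u , w) ⊎ edge e ≡ (w , u)

  joins-sym : ∀ {e u w} → Joins e u w → Joins e w u
  joins-sym (inj₁ p) = inj₂ p
  joins-sym (inj₂ p) = inj₁ p

  edge-ordered : ∀ {e u w} → edge e ≡ (u , w) → u F.< w
  edge-ordered {e} p = subst (λ q → proj₁ q F.< proj₂ q) p (edge-ord e)

  joins⇒≢ : ∀ {e u w} → Joins e u w → u ≢ w
  joins⇒≢ (inj₁ p) refl = FP.<-irrefl refl (edge-ordered p)
  joins⇒≢ (inj₂ p) refl = FP.<-irrefl refl (edge-ordered p)

  joins-endpoint : ∀ {e u u′ a w} → Joins e u u′ → Joins e a w → w ≡ u ⊎ w ≡ u′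
  joins-endpoint (inj₁ p) (inj₁ q) = inj₂ (cong proj₂ (trans (sym q) p))
  joins-endpoint (inj₁ p) (inj₂ q) = inj₁ (cong proj₁ (trans (sym q) p))
  joins-endpoint (inj₂ p) (inj₁ q) = inj₁ (cong proj₂ (trans (sym q) p))
  joins-endpoint (inj₂ p) (inj₂ q) = inj₂ (cong proj₁ (trans (sym q) p))

  joins-injective : ∀ {e e′ u w} → Joins e u w → Joins e′ u w → e ≡ e′
  joins-injective (inj₁ p) (inj₁ q) = edge-inj (trans p (sym q))
  joins-injective (inj₂ p) (inj₂ q) = edge-inj (trans p (sym q))
  joins-injective (inj₁ p) (inj₂ q) = ⊥-elim (FP.<-asym (edge-ordered p) (edge-ordered q))
  joins-injective (inj₂ p) (inj₁ q) = ⊥-elim (FP.<-asym (edge-ordered p) (edge-ordered q))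

  incident-joins : ∀ {e u w} x → Joins e u w → incident G x e ≡ does (u F.≟ x) ∨ does (w F.≟ x)
  incident-joins x (inj₁ p) rewrite p = refl
  incident-joins {u = u} {w} x (inj₂ p) rewrite p = ∨-comm (does (w F.≟ x)) (does (u F.≟ x))

  joins⇒incident : ∀ {e u w} → Joins e u w → incident G u e ≡ true
  joins⇒incident {u = u} {w} j =
    trans (incident-joins u j) (cong (_∨ does (w F.≟ u)) (dec-true (u F.≟ u) refl))

  incident⇒joins : ∀ {e x} → incident G x e ≡ true → ∃ λ z → Joins e z x
  incident⇒joins {e} {x} h with proj₁ (edge e) F.≟ x | proj₂ (edge e) F.≟ x
  ... | yes refl | _        = proj₂ (edge e) , inj₂ refl
  ... | no _     | yes refl = proj₁ (edge e) , inj₁ refl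

  data Trail : Fin c → Fin c → List (Fin n) → Set where
    []  : ∀ {u} → Trail u u []
    _∷_ : ∀ {u w v e es} → Joins e u w → Trail w v es → Trail u v (e ∷ es)

  _++ᵗ_ : ∀ {u v x es fs} → Trail u v es → Trail v x fs → Trail u x (es ++ fs)
  []      ++ᵗ t′ = t′
  (j ∷ t) ++ᵗ t′ = j ∷ (t ++ᵗ t′)

  trail-parity : ∀ {u v es} x → Trail u v es →
    parity (countList (incident G x) es) ≡ toParity (does (u F.≟ x)) ℙ.+ toParity (does (v F.≟ x))
  trail-parity {u} x [] = sym (p+p≡0ℙ (toParity (does (u F.≟ x))))
  trail-parity {u} {v} x (_∷_ {w = w} {e = e} {es = es} j t) = begin
    parity (indicator (incident G x e) + countList (incident G x) es)
      ≡⟨ +-homo-+ (indicator (incident G x e)) _ ⟩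
    parity (indicator (incident G x e)) ℙ.+ parity (countList (incident G x) es)
      ≡⟨ cong₂ ℙ._+_ (trans (parity-indicator _) (cong toParity (incident-joins x j))) (trail-parity x t) ⟩
    toParity (u≟x ∨ w≟x) ℙ.+ (toParity w≟x ℙ.+ toParity (does (v F.≟ x)))
      ≡⟨ toParity-∨ u≟x w≟x _ not-both ⟩
    toParity u≟x ℙ.+ toParity (does (v F.≟ x)) ∎
    where
    open ≡-Reasoning
    u≟x w≟x : Bool
    u≟x = does (u F.≟ x)
    w≟x = does (w F.≟ x)
    not-both : u≟x ∧ w≟x ≡ false
    not-both with u F.≟ x | w F.≟ x
    ... | yes refl | yes refl = contradiction refl (joins⇒≢ j)
    ... | yes _    | no _     = refl
    ... | no _     | _        = refl

  record Circuit (k : ℕ) : Set where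
    field
      vertexAt         : Fin k → Fin c
      edgeAt           : Fin k → Fin n
      edgeAt-injective : ∀ {i j} → edgeAt i ≡ edgeAt j → i ≡ j
      edgeAt-joins     : ∀ i → Joins (edgeAt i) (vertexAt i) (vertexAt (next i))

  EulerCircuit : Set
  EulerCircuit = Circuit n

  vertex : ∀ {u v es} → Trail u v es → ℕ → Fin c
  vertex {u} []      _       = u
  vertex {u} (_ ∷ _) zero    = u
  vertex     (_ ∷ t) (suc i) = vertex t i

  vertex-start : ∀ {u v es} (t : Trail u v es) → vertex t 0 ≡ u
  vertex-start []      = refl
  vertex-start (_ ∷ _) = refl

  vertex-end : ∀ {u v es} (t : Trail u v es) → vertex t (length es) ≡ v
  vertex-end []      = refl
  vertex-end (_ ∷ t) = vertex-end t

  lookup-joins : ∀ {u v es} (t : Trail u v es) (i : Fin (length es)) →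
    Joins (lookup es i) (vertex t (toℕ i)) (vertex t (suc (toℕ i)))
  lookup-joins (j ∷ t) F.zero    = subst (Joins _ _) (sym (vertex-start t)) j
  lookup-joins (j ∷ t) (F.suc i) = lookup-joins t i

  emptyCircuit : Circuit 0
  emptyCircuit = record
    { vertexAt = λ () ; edgeAt = λ () ; edgeAt-injective = λ { {()} } ; edgeAt-joins = λ () }

  trail⇒circuit : ∀ {u es} → Trail u u es → Unique es → Circuit (length es)
  trail⇒circuit {es = []}     t u = emptyCircuit
  trail⇒circuit {v} {es = e ∷ es} t u = record
    { vertexAt         = λ i → vertex t (toℕ i)
    ; edgeAt           = lookup (e ∷ es)
    ; edgeAt-injective = lookup-injective u
    ; edgeAt-joins     = λ i → subst (Joins _ _) (wraps-around i) (lookup-joins t i)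
    }
    where
    wraps-around : ∀ i → vertex t (suc (toℕ i)) ≡ vertex t (toℕ (next i))
    wraps-around i with last-or-below i
    ... | inj₁ below = cong (vertex t) (sym (toℕ-next-below i below))
    ... | inj₂ last  = begin
      vertex t (suc (toℕ i))   ≡⟨ cong (vertex t ∘ suc) last ⟩
      vertex t (length (e ∷ es)) ≡⟨ vertex-end t ⟩
      v                        ≡⟨ vertex-start t ⟨
      vertex t 0               ≡⟨ cong (vertex t) (toℕ-next-last i last) ⟨
      vertex t (toℕ (next i))  ∎
      where open ≡-Reasoning

  closed-walk⇒cycle : ∀ {h cs} → Unique (h ∷ cs) → Linked (Adj G) ((h ∷ cs) ++ h ∷ []) →
    ContainsCycle G (length (h ∷ cs))
  closed-walk⇒cycle {h} {cs} u l = lookup vs , lookup-injective u , adj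
    where
    vs ws : List (Fin c)
    vs = h ∷ cs
    ws = vs ++ h ∷ []
    index : ∀ t → t ≤ length vs → Fin (length ws)
    index t t≤ = F.fromℕ< (subst (t <_) (sym (trans (length-++ vs) (+-comm _ 1))) (s≤s t≤))
    toℕ-index : ∀ t t≤ → toℕ (index t t≤) ≡ t
    toℕ-index t t≤ = FP.toℕ-fromℕ< _
    adj : ∀ i → Adj G (lookup vs i) (lookup vs (next i))
    adj i = subst₂ (Adj G) here-≡ there-≡ (Linked-lookup l i₁ i₂ (trans toℕ-i₂ (cong suc (sym toℕ-i₁))))
      where
      i₁ i₂ : Fin (length ws)
      i₁ = index (toℕ i) (<⇒≤ (FP.toℕ<n i))
      i₂ = index (suc (toℕ i)) (FP.toℕ<n i)
      toℕ-i₁ : toℕ i₁ ≡ toℕ i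
      toℕ-i₁ = toℕ-index _ (<⇒≤ (FP.toℕ<n i))
      toℕ-i₂ : toℕ i₂ ≡ suc (toℕ i)
      toℕ-i₂ = toℕ-index _ (FP.toℕ<n i)
      here-≡ : lookup ws i₁ ≡ lookup vs i
      here-≡ = lookup-++ˡ vs i₁ i toℕ-i₁
      there-≡ : lookup ws i₂ ≡ lookup vs (next i)
      there-≡ with last-or-below i
      ... | inj₁ below = lookup-++ˡ vs i₂ (next i) (trans toℕ-i₂ (sym (toℕ-next-below i below)))
      ... | inj₂ last  = trans (lookup-++-length vs i₂ (trans toℕ-i₂ (cong suc last)))
                               (cong (lookup vs) (sym (FP.toℕ-injective {j = F.zero} (toℕ-next-last i last))))

  OnTrail : Fin c → Fin c → List (Fin n) → Fin c → Set
  OnTrail s t es w = ∃₂ λ es₁ es₂ → Trail s w es₁ × Trail w t es₂ × es ≡ es₁ ++ es₂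

  onTrail-joins : ∀ {s t es e a w} → Trail s t es → e ∈ es → Joins e a w → OnTrail s t es w
  onTrail-joins (_∷_ {e = e} {es = es} j t) (here refl) j′ with joins-endpoint j j′
  ... | inj₁ refl = [] , e ∷ es , [] , j ∷ t , refl
  ... | inj₂ refl = e ∷ [] , es , j ∷ [] , t , refl
  onTrail-joins (_∷_ {e = e} j t) (there e∈) j′ with onTrail-joins t e∈ j′
  ... | es₁ , es₂ , t₁ , t₂ , refl = e ∷ es₁ , es₂ , j ∷ t₁ , t₂ , refl

module EulerTrail {c n : ℕ} (G : SimpleGraph c n)
  (connected : Connected G) (even-degree : ∀ v → Even (degree G v)) where
  open SimpleGraph G
  open Graph G

  unused : List (Fin n) → Fin c → Fin n → Bool
  unused ℓ x e = incident G x e ∧ not (e ∈ᵇ ℓ)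

  HasUnused : List (Fin n) → Fin c → Set
  HasUnused ℓ x = ∃ λ e → unused ℓ x e ≡ true

  hasUnused? : ∀ ℓ x → Dec (HasUnused ℓ x)
  hasUnused? ℓ x = FP.any? (λ e → unused ℓ x e ≟ᵇ true)

  unused⇒∉ : ∀ {ℓ x e} → unused ℓ x e ≡ true → e ∉ ℓ
  unused⇒∉ {ℓ} {x} {e} h e∈ℓ
    with () ← trans (sym (proj₂ (∧-true {incident G x e} h))) (cong not (∈⇒∈ᵇ e∈ℓ))

  degree-split : ∀ x ℓ → Unique ℓ → degree G x ≡ countList (incident G x) ℓ + count (unused ℓ x)
  degree-split x ℓ u =
    trans (count-split (incident G x) (_∈ᵇ ℓ)) (cong (_+ count (unused ℓ x)) (count-∧-∈ᵇ _ ℓ u))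

  -- An odd number of the used edges meet x, but degree x is even.
  unused-at-open-end : ∀ {x z ps rest} → x ≢ z → Trail x z ps → Trail z z rest →
    Unique (ps ++ rest) → HasUnused (ps ++ rest) x
  unused-at-open-end {x} {z} {ps} {rest} x≢z P C u with hasUnused? (ps ++ rest) x
  ... | yes found = found
  ... | no none   = contradiction (trans (sym odd) (parity-even (even-degree x))) λ ()
    where
    open ≡-Reasoning
    ℓ : List (Fin n)
    ℓ = ps ++ rest
    [_] : Fin c → Parity
    [ y ] = toParity (does (y F.≟ x))
    odd : parity (degree G x) ≡ 1ℙ
    odd = begin
      parity (degree G x)
        ≡⟨ cong parity (degree-split x ℓ u) ⟩
      parity (countList (incident G x) ℓ + count (unused ℓ x))
        ≡⟨ cong (λ k → parity (countList (incident G x) ℓ + k))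
                (count-none _ (λ e → ¬-not (λ h → none (e , h)))) ⟩
      parity (countList (incident G x) ℓ + 0)
        ≡⟨ cong parity (trans (+-identityʳ _) (countList-++ _ ps rest)) ⟩
      parity (countList (incident G x) ps + countList (incident G x) rest)
        ≡⟨ +-homo-+ (countList (incident G x) ps) _ ⟩
      parity (countList (incident G x) ps) ℙ.+ parity (countList (incident G x) rest)
        ≡⟨ cong₂ ℙ._+_ (trail-parity x P) (trail-parity x C) ⟩
      ([ x ] ℙ.+ [ z ]) ℙ.+ ([ z ] ℙ.+ [ z ])
        ≡⟨ cong₂ (λ a b → (toParity a ℙ.+ toParity b) ℙ.+ (toParity b ℙ.+ toParity b))
                 (dec-true (x F.≟ x) refl) (dec-false (z F.≟ x) (x≢z ∘ sym)) ⟩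
      1ℙ ∎

  -- P is extended backwards along unused edges until it closes up; every step uses a new edge,
  -- so the fuel k never runs out.
  close-up : ∀ k {z x ps rest} → Trail z z rest → Trail x z ps → Unique (ps ++ rest) →
    n ≤ length (ps ++ rest) + k → length rest < length (ps ++ rest) →
    ∃ λ cs → Trail z z cs × Unique cs × length rest < length cs
  close-up k {z} {x} C P u bound grown with x F.≟ z
  ... | yes refl = _ , P ++ᵗ C , u , grown
  ... | no x≢z with unused-at-open-end x≢z P C u
  ...   | e , ue with k
  ...     | zero  = ⊥-elim (<⇒≱ (∉⇒length< u (unused⇒∉ ue)) (subst (n ≤_) (+-identityʳ _) bound))
  ...     | suc k = close-up k C (proj₂ (incident⇒joins (proj₁ (∧-true ue))) ∷ P)
                      (∉⇒Unique-∷ (unused⇒∉ ue) u) (subst (n ≤_) (+-suc _ k) bound) (≤-trans grown (n≤1+n _))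

  first-with-unused : ∀ {y es a b} → Trail y y es → Reach G a b → OnTrail y y es a → HasUnused es b →
    ∃ λ z → OnTrail y y es z × HasUnused es z
  first-with-unused C here on h = _ , on , h
  first-with-unused {es = es} {a} C (step (e , j) r) on h with hasUnused? es a
  ... | yes h′   = a , on , h′
  ... | no none = first-with-unused C r (onTrail-joins C e∈es j) h
    where
    e∈es : e ∈ es
    e∈es with e ∈ᵇ es in e∈
    ... | true  = ∈ᵇ⇒∈ es e∈
    ... | false = contradiction (e , cong₂ _∧_ (joins⇒incident j) (cong not e∈)) none

  -- Hierholzer's step: rotate the circuit to a vertex z with an unused edge e and splice in a closed
  -- trail at z that starts with e.
  grow : ∀ k {y es} → Trail y y es → Unique es → n ≤ length es + k →
    ∃₂ λ y′ es′ → Trail y′ y′ es′ × Unique es′ × length es′ ≡ n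
  grow k {y} {es} C u bound with FP.any? (λ e → e ∈ᵇ es ≟ᵇ false)
  ... | no all-used =
    y , es , C , u ,
    trans (sym (count≡length (λ _ → true) es u (All.tabulate (λ _ → refl))
                 (λ e _ → ∈ᵇ⇒∈ es (¬-not (λ h → all-used (e , h))))))
          (count-all n)
  grow zero {y} {es} C u bound | yes (e₀ , e₀∉) =
    ⊥-elim (<⇒≱ (∉⇒length< u (∈ᵇ≡false⇒∉ e₀∉)) (subst (n ≤_) (+-identityʳ _) bound))
  grow (suc k) {y} {es} C u bound | yes (e₀ , e₀∉)
    with first-with-unused C (connected y (proj₁ (edge e₀))) ([] , es , [] , C , refl)
           (e₀ , cong₂ _∧_ (joins⇒incident (inj₁ refl)) (cong not e₀∉))
  ... | z , (es₁ , es₂ , C₁ , C₂ , refl) , e , ue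
    with close-up (suc n) (C₂ ++ᵗ C₁) (proj₂ (incident⇒joins (proj₁ (∧-true ue))) ∷ [])
           (∉⇒Unique-∷ (unused⇒∉ ue ∘ ∈-resp-↭ (++-comm es₂ es₁)) (Unique-++-comm es₁ u))
           (≤-trans (n≤1+n n) (m≤n+m (suc n) (suc (length (es₂ ++ es₁))))) ≤-refl
  ... | cs , C′ , u′ , longer = grow k C′ u′ bound′
    where
    rotated : length (es₂ ++ es₁) ≡ length (es₁ ++ es₂)
    rotated = trans (length-++ es₂) (trans (+-comm (length es₂) _) (sym (length-++ es₁)))
    bound′ : n ≤ length cs + k
    bound′ = ≤-trans bound (≤-trans (≤-reflexive (+-suc _ k)) (+-monoˡ-≤ k (subst (_< length cs) rotated longer)))

  eulerCircuit : Fin c → EulerCircuit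
  eulerCircuit y with grow n {y} [] [] ≤-refl
  ... | _ , es , C , u , length≡n = subst Circuit length≡n (trail⇒circuit C u)

eulerian⇒eulerCircuit : ∀ {c n} (G : SimpleGraph c n) → Eulerian G → Graph.EulerCircuit G
eulerian⇒eulerCircuit {n = zero}  G _                 = Graph.emptyCircuit G
eulerian⇒eulerCircuit {n = suc _} G (connected , even) =
  EulerTrail.eulerCircuit G connected even (proj₁ (SimpleGraph.edge G F.zero))

-- Facets of the cyclic polytope

prefixCount : ∀ {n} → Vec Bool n → ℕ → ℕ
prefixCount []      _       = 0
prefixCount (b ∷ S) zero    = 0
prefixCount (b ∷ S) (suc t) = indicator b + prefixCount S t

prefixCount-zero : ∀ {n} (S : Vec Bool n) → prefixCount S 0 ≡ 0
prefixCount-zero []      = refl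
prefixCount-zero (_ ∷ _) = refl

prefixCount-suc : ∀ {n} (S : Vec Bool n) (x : Fin n) →
  prefixCount S (suc (toℕ x)) ≡ prefixCount S (toℕ x) + indicator (V.lookup S x)
prefixCount-suc (b ∷ S) F.zero    = trans (cong (indicator b +_) (prefixCount-zero S)) (+-comm (indicator b) 0)
prefixCount-suc (b ∷ S) (F.suc x) =
  trans (cong (indicator b +_) (prefixCount-suc S x)) (sym (+-assoc (indicator b) _ _))

prefixCount-all : ∀ {n} (S : Vec Bool n) → prefixCount S n ≡ ∣ S ∣
prefixCount-all []          = refl
prefixCount-all (true ∷ S)  = cong suc (prefixCount-all S)
prefixCount-all (false ∷ S) = prefixCount-all S

count-lookup : ∀ {n} (S : Vec Bool n) → count (V.lookup S) ≡ ∣ S ∣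
count-lookup []          = refl
count-lookup (true ∷ S)  = cong suc (count-lookup S)
count-lookup (false ∷ S) = count-lookup S

count-below : ∀ {n} (S : Vec Bool n) t → count (λ j → V.lookup S j ∧ (toℕ j <ᵇ t)) ≡ prefixCount S t
count-below []      t       = refl
count-below (b ∷ S) zero    =
  cong₂ _+_ (cong indicator (∧-zeroʳ b)) (count-none _ (λ j → ∧-zeroʳ (V.lookup S j)))
count-below (b ∷ S) (suc t) = cong₂ _+_ (cong indicator (∧-identityʳ b)) (count-below S t)

count-strictly-between : ∀ {n} (S : Vec Bool n) a b → a < b →
  count (λ j → V.lookup S j ∧ ((a <ᵇ toℕ j) ∧ (toℕ j <ᵇ b))) + prefixCount S (suc a) ≡ prefixCount S b
count-strictly-between []      a       b       _ = refl
count-strictly-between (c ∷ S) zero    (suc b) _ rewrite ∧-zeroʳ c | count-below S b | prefixCount-zero S =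
  trans (cong (prefixCount S b +_) (+-identityʳ (indicator c))) (+-comm (prefixCount S b) (indicator c))
count-strictly-between (c ∷ S) (suc a) (suc b) (s≤s a<b) rewrite ∧-zeroʳ c =
  trans (x∙yz≈y∙xz _ (indicator c) (prefixCount S (suc a)))
        (cong (indicator c +_) (count-strictly-between S a b a<b))

record ConsecutivePairs {k : ℕ} (S : Subset (suc k)) (m : ℕ) : Set where
  field
    first       : Fin (suc k) → Bool
    count-first : count first ≡ m
    first⇒pair  : ∀ x → first x ≡ true → x ∈ₛ S × next x ∈ₛ S
    pair-cover  : ∀ y → y ∈ₛ S → ∃ λ x → first x ≡ true × InPair x y

module FacetPairing {k m : ℕ} (S : Subset (suc k)) (size : ∣ S ∣ ≡ m + m)
  (gale : ∀ i j → i ∉ₛ S → j ∉ₛ S → Even (between S i j)) where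

  -- By Gale's evenness condition Q takes one value ε at all nonmembers of S; a member x with
  -- Q x ≡ ε pairs with next x.
  Q : Fin (suc k) → Parity
  Q x = parity (prefixCount S (toℕ x))

  Q-suc : ∀ x → parity (prefixCount S (suc (toℕ x))) ≡ Q x ℙ.+ toParity (V.lookup S x)
  Q-suc x = trans (cong parity (prefixCount-suc S x))
                  (trans (+-homo-+ (prefixCount S (toℕ x)) _) (cong (Q x ℙ.+_) (parity-indicator _)))

  Q-next : ∀ x → Q (next x) ≡ Q x ℙ.+ toParity (V.lookup S x)
  Q-next x with last-or-below x
  ... | inj₁ below = trans (cong (parity ∘ prefixCount S) (toℕ-next-below x below)) (Q-suc x)
  ... | inj₂ last  = begin
    Q (next x)                            ≡⟨ cong (parity ∘ prefixCount S) (toℕ-next-last x last) ⟩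
    parity (prefixCount S 0)              ≡⟨ cong parity (prefixCount-zero S) ⟩
    0ℙ                                    ≡⟨ p+p≡0ℙ (parity m) ⟨
    parity m ℙ.+ parity m                 ≡⟨ +-homo-+ m m ⟨
    parity (m + m)                        ≡⟨ cong parity (trans (sym size) (sym (prefixCount-all S))) ⟩
    parity (prefixCount S (suc k))        ≡⟨ cong (parity ∘ prefixCount S ∘ suc) last ⟨
    parity (prefixCount S (suc (toℕ x))) ≡⟨ Q-suc x ⟩
    Q x ℙ.+ toParity (V.lookup S x)       ∎
    where open ≡-Reasoning

  lookup≡false⇒∉ : ∀ {i} → V.lookup S i ≡ false → i ∉ₛ S
  lookup≡false⇒∉ h i∈ with () ← trans (sym h) (VP.[]=⇒lookup i∈)

  nonmember-step : ∀ i j → V.lookup S i ≡ false → V.lookup S j ≡ false → toℕ i < toℕ j → Q j ≡ Q i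
  nonmember-step i j i∉ j∉ i<j = begin
    Q j
      ≡⟨ cong parity (count-strictly-between S _ _ i<j) ⟨
    parity (between S i j + prefixCount S (suc (toℕ i)))
      ≡⟨ +-homo-+ (between S i j) _ ⟩
    parity (between S i j) ℙ.+ parity (prefixCount S (suc (toℕ i)))
      ≡⟨ cong₂ ℙ._+_ (parity-even (gale i j (lookup≡false⇒∉ i∉) (lookup≡false⇒∉ j∉))) (Q-suc i) ⟩
    Q i ℙ.+ toParity (V.lookup S i)
      ≡⟨ cong (λ b → Q i ℙ.+ toParity b) i∉ ⟩
    Q i ℙ.+ 0ℙ
      ≡⟨ ℙₚ.+-identityʳ (Q i) ⟩
    Q i ∎
    where open ≡-Reasoning

  nonmembers-agree : ∀ i j → V.lookup S i ≡ false → V.lookup S j ≡ false → Q i ≡ Q j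
  nonmembers-agree i j i∉ j∉ with FP.<-cmp i j
  ... | tri< i<j _ _ = sym (nonmember-step i j i∉ j∉ i<j)
  ... | tri≈ _ refl _ = refl
  ... | tri> _ _ j<i = nonmember-step j i j∉ i∉ j<i

  -- with no nonmember at all, any parity will do
  nonmember-parity : ∃ λ ε → ∀ j → V.lookup S j ≡ false → Q j ≡ ε
  nonmember-parity with FP.any? (λ z → V.lookup S z ≟ᵇ false)
  ... | yes (z , z∉) = Q z , λ j j∉ → nonmembers-agree j z j∉ z∉
  ... | no none      = 0ℙ , λ j j∉ → contradiction (j , j∉) none

  ε : Parity
  ε = proj₁ nonmember-parity

  nonmember⇒ε : ∀ j → V.lookup S j ≡ false → Q j ≡ ε
  nonmember⇒ε = proj₂ nonmember-parity

  off-parity⇒∈ : ∀ y → Q y ≢ ε → V.lookup S y ≡ true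
  off-parity⇒∈ y y≢ε with V.lookup S y in e
  ... | true  = refl
  ... | false = contradiction (nonmember⇒ε y e) y≢ε

  first second : Fin (suc k) → Bool
  first  x = V.lookup S x ∧ does (Q x ℙₚ.≟ ε)
  second x = V.lookup S x ∧ not (does (Q x ℙₚ.≟ ε))

  first⇒next : ∀ x → V.lookup S x ≡ true → Q x ≡ ε → Q (next x) ≡ ε ⁻¹
  first⇒next x x∈ Qx≡ε =
    trans (Q-next x) (trans (cong₂ (λ a b → a ℙ.+ toParity b) Qx≡ε x∈) (ℙₚ.+-comm ε 1ℙ))

  second⇒prev : ∀ y → V.lookup S y ≡ true → Q y ≡ ε ⁻¹ →
    ∃ λ x → V.lookup S x ≡ true × Q x ≡ ε × next x ≡ y
  second⇒prev y _ Qy≡ε⁻¹ = x , x∈ , Qx≡ε , next-prev y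
    where
    open ≡-Reasoning
    x : Fin (suc k)
    x = prev y
    Qy≡ : Q y ≡ Q x ℙ.+ toParity (V.lookup S x)
    Qy≡ = trans (cong Q (sym (next-prev y))) (Q-next x)
    x∈ : V.lookup S x ≡ true
    x∈ with V.lookup S x in e
    ... | true  = refl
    ... | false = contradiction (begin
      ε                                ≡⟨ nonmember⇒ε x e ⟨
      Q x                              ≡⟨ ℙₚ.+-identityʳ (Q x) ⟨
      Q x ℙ.+ 0ℙ                       ≡⟨ cong (λ b → Q x ℙ.+ toParity b) e ⟨
      Q x ℙ.+ toParity (V.lookup S x)  ≡⟨ Qy≡ ⟨
      Q y                              ≡⟨ Qy≡ε⁻¹ ⟩
      ε ⁻¹                             ∎) (p≢p⁻¹ ε)
    Qx≡ε : Q x ≡ ε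
    Qx≡ε = ⁻¹-injective (begin
      Q x ⁻¹                           ≡⟨ ℙₚ.+-comm 1ℙ (Q x) ⟩
      Q x ℙ.+ 1ℙ                       ≡⟨ cong (λ b → Q x ℙ.+ toParity b) x∈ ⟨
      Q x ℙ.+ toParity (V.lookup S x)  ≡⟨ Qy≡ ⟨
      Q y                              ≡⟨ Qy≡ε⁻¹ ⟩
      ε ⁻¹                             ∎)

  first-parts : ∀ {x} → first x ≡ true → V.lookup S x ≡ true × Q x ≡ ε
  first-parts {x} h = proj₁ (∧-true h) , from-does (Q x ℙₚ.≟ ε) (proj₂ (∧-true h))

  first⇒next-off : ∀ x → first x ≡ true → Q (next x) ≢ ε
  first⇒next-off x h e = p≢p⁻¹ ε (trans (sym e) (first⇒next x (proj₁ (first-parts h)) (proj₂ (first-parts h))))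

  first⇒second-next : ∀ x → first x ≡ true → second (next x) ≡ true
  first⇒second-next x h =
    cong₂ _∧_ (off-parity⇒∈ (next x) off) (cong not (dec-false (Q (next x) ℙₚ.≟ ε) off))
    where
    off : Q (next x) ≢ ε
    off = first⇒next-off x h

  second⇒first-prev : ∀ y → second y ≡ true → ∃ λ x → first x ≡ true × next x ≡ y
  second⇒first-prev y h
    with second⇒prev y (proj₁ (∧-true h)) (≢⇒≡⁻¹ (from-not-does (Q y ℙₚ.≟ ε) (proj₂ (∧-true h))))
  ... | x , x∈ , Qx≡ε , next-x≡y = x , cong₂ _∧_ x∈ (dec-true (Q x ℙₚ.≟ ε) Qx≡ε) , next-x≡y

  count-first : count first ≡ m
  count-first = half (begin
    count first + count first  ≡⟨ cong (count first +_) (count-bijection first second next next-injective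
                                                            first⇒second-next second⇒first-prev) ⟩
    count first + count second ≡⟨ count-split (V.lookup S) (λ x → does (Q x ℙₚ.≟ ε)) ⟨
    count (V.lookup S)         ≡⟨ count-lookup S ⟩
    ∣ S ∣                      ≡⟨ size ⟩
    m + m                      ∎)
    where
    open ≡-Reasoning
    half : ∀ {a} → a + a ≡ m + m → a ≡ m
    half {a} e = trans (n≡⌊n+n/2⌋ a) (trans (cong ⌊_/2⌋ e) (sym (n≡⌊n+n/2⌋ m)))

  cover : ∀ y → V.lookup S y ≡ true → ∃ λ x → first x ≡ true × InPair x y
  cover y y∈ with Q y ℙₚ.≟ ε
  ... | yes Qy≡ε = y , cong₂ _∧_ y∈ (dec-true (Q y ℙₚ.≟ ε) Qy≡ε) , inj₁ refl
  ... | no Qy≢ε with second⇒prev y y∈ (≢⇒≡⁻¹ Qy≢ε)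
  ...   | x , x∈ , Qx≡ε , refl = x , cong₂ _∧_ x∈ (dec-true (Q x ℙₚ.≟ ε) Qx≡ε) , inj₂ refl

facet-pairs : ∀ {k m} (S : Subset (suc k)) → IsFCEdge (2 * m) (suc k) S → ConsecutivePairs S m
facet-pairs {m = m} S (size , gale) = record
  { first       = first
  ; count-first = count-first
  ; first⇒pair  = λ x h → VP.lookup⇒[]= x S (proj₁ (first-parts h)) ,
                           VP.lookup⇒[]= (next x) S (off-parity⇒∈ (next x) (first⇒next-off x h))
  ; pair-cover  = λ y y∈ → cover y (VP.[]=⇒lookup y∈)
  }
  where open FacetPairing {m = m} S (trans size (cong (m +_) (+-identityʳ m))) gale

-- Short cycles in a family of edges of minimum degree two

module EdgeFamily {c n I : ℕ} (G : SimpleGraph c n) (sel : Fin I → Bool) (ε : Fin I → Fin n)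
  (ε-injective : ∀ {x y} → ε x ≡ ε y → x ≡ y)
  (min-degree-two : ∀ x {v w} → sel x ≡ true → Graph.Joins G (ε x) v w →
                    ∃ λ x′ → sel x′ ≡ true × x′ ≢ x × ∃ (Graph.Joins G (ε x′) v))
  where
  open SimpleGraph G
  open Graph G

  Selected : Fin I → Set
  Selected x = sel x ≡ true

  JoinedBy : List (Fin I) → Fin c → Fin c → Set
  JoinedBy xs a b = ∃ λ x → x ∈ xs × Joins (ε x) a b

  joinedBy⇒adj : ∀ {xs a b} → JoinedBy xs a b → Adj G a b
  joinedBy⇒adj (x , _ , j) = ε x , j

  EndsIn : List (Fin c) → Fin I → Set
  EndsIn vs x = ∀ {v w} → Joins (ε x) v w → v ∈ vs

  ends-in : ∀ {x a b vs} → Joins (ε x) a b → a ∈ vs → b ∈ vs → EndsIn vs x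
  ends-in j a∈ b∈ j′ with joins-endpoint j (joins-sym j′)
  ... | inj₁ refl = a∈
  ... | inj₂ refl = b∈

  -- a walk from s, with its vertices listed from the current end back to s, and the edges used
  data Path (s : Fin c) : List (Fin c) → List (Fin I) → Set where
    start  : Path s (s ∷ []) []
    extend : ∀ {u v vs xs} x → Joins (ε x) u v → Path s (u ∷ vs) xs → Path s (v ∷ u ∷ vs) (x ∷ xs)

  path-ends : ∀ {s vs xs} → Path s vs xs → All (EndsIn vs) xs
  path-ends start          = []
  path-ends (extend x j P) =
    ends-in j (there (here refl)) (here refl) ∷ All.map (λ e {_} {_} j′ → there (e j′)) (path-ends P)

  path-length : ∀ {s vs xs} → Path s vs xs → length vs ≡ suc (length xs)
  path-length start          = refl
  path-length (extend x j P) = cong suc (path-length P)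

  path-start : ∀ {s vs xs} → Path s vs xs → s ∈ vs
  path-start start          = here refl
  path-start (extend x j P) = there (path-start P)

  path-linked : ∀ {s vs xs es} → (∀ {y} → y ∈ xs → y ∈ es) → Path s vs xs →
    ∀ {t} → JoinedBy es s t → Linked (JoinedBy es) (vs ++ t ∷ [])
  path-linked sub start          r = r ∷ [-]
  path-linked sub (extend x j P) r = (x , sub (here refl) , joins-sym j) ∷ path-linked (sub ∘ there) P r

  cut : ∀ {s a vs xs v′} → Path s (a ∷ vs) xs → v′ ∈ (a ∷ vs) →
    ∃₂ λ ws is → Path v′ (a ∷ ws) is ×
                 (∃ λ r → a ∷ vs ≡ (a ∷ ws) ++ r) × (∃ λ r → xs ≡ is ++ r)
  cut start (here refl) = [] , [] , start , ([] , refl) , ([] , refl)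
  cut (extend {u} {vs = vs} {xs} x j P) (here refl) = [] , [] , start , (u ∷ vs , refl) , (x ∷ xs , refl)
  cut {a = a} (extend {u} x j P) (there v′∈) with cut P v′∈
  ... | ws , is , P′ , (r , vs≡) , (r′ , xs≡) =
    u ∷ ws , x ∷ is , extend x j P′ , (r , cong (a ∷_) vs≡) , (r′ , cong (x ∷_) xs≡)

  record FamilyCycle : Set where
    field
      head           : Fin c
      rest           : List (Fin c)
      distinct       : Unique (head ∷ rest)
      edges          : List (Fin I)
      edges-distinct : Unique edges
      edges-selected : All Selected edges
      edges-length   : length edges ≡ length (head ∷ rest)
      closed         : Linked (JoinedBy edges) ((head ∷ rest) ++ head ∷ [])
      edges-ends     : All (EndsIn (head ∷ rest)) edges
      long           : 3 ≤ length (head ∷ rest)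

  close : ∀ {s v vs x xs} → Path s (v ∷ vs) (x ∷ xs) → Unique (v ∷ vs) → Unique (x ∷ xs) →
    All Selected (x ∷ xs) → ∀ {x′ v′} → Selected x′ → x′ ≢ x → Joins (ε x′) v v′ → v′ ∈ (v ∷ vs) →
    FamilyCycle
  close {v = v} {x = x} {xs} P@(extend _ _ P₀) uv ux sx {x′} {v′} sx′ x′≢x j′ v′∈ with cut P v′∈
  ... | ws , is , P′ , (r , vs≡) , (r′ , xs≡) = record
    { head           = v
    ; rest           = ws
    ; distinct       = Unique-++⁻ˡ (v ∷ ws) (subst Unique vs≡ uv)
    ; edges          = x′ ∷ is
    ; edges-distinct = ∉⇒Unique-∷ x′∉is (Unique-++⁻ˡ is (subst Unique xs≡ ux))
    ; edges-selected = sx′ ∷ Allₚ.++⁻ˡ is (subst (All Selected) xs≡ sx)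
    ; edges-length   = sym (path-length P′)
    ; closed         = path-linked there P′ (x′ , here refl , joins-sym j′)
    ; edges-ends     = ends-in j′ (here refl) (path-start P′) ∷ path-ends P′
    ; long           = at-least-three ws P′ xs≡
    }
    where
    x′∉ : x′ ∉ x ∷ xs
    x′∉ (here x′≡x)  = x′≢x x′≡x
    x′∉ (there x′∈) = Uniqueₚ.Unique[x∷xs]⇒x∉xs uv (All.lookup (path-ends P₀) x′∈ j′)
    x′∉is : x′ ∉ is
    x′∉is x′∈ = x′∉ (subst (x′ ∈_) (sym xs≡) (∈-++⁺ˡ x′∈))
    -- two vertices would make x′ a second edge joining the same pair as x
    at-least-three : ∀ ws′ {is′} → Path v′ (v ∷ ws′) is′ → x ∷ xs ≡ is′ ++ r′ →
      3 ≤ length (v ∷ ws′)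
    at-least-three []          start              _    = contradiction refl (joins⇒≢ j′)
    at-least-three (_ ∷ [])    (extend y j start) refl =
      contradiction (ε-injective (joins-injective j′ (joins-sym j))) x′≢x
    at-least-three (_ ∷ _ ∷ _) _                  _    = s≤s (s≤s (s≤s z≤n))

  -- k is fuel: the vertices of the path are distinct, so a vertex repeats within c steps
  walk : (k : ℕ) → ∀ {s v vs x xs} → Path s (v ∷ vs) (x ∷ xs) → Unique (v ∷ vs) → Unique (x ∷ xs) →
    All Selected (x ∷ xs) → c < length (v ∷ vs) + k → FamilyCycle
  walk k {v = v} {vs} P@(extend x j _) uv ux sx bound
    with min-degree-two x (All.head sx) (joins-sym j)
  ... | x′ , sx′ , x′≢x , v′ , j′ with Any.any? (v′ F.≟_) (v ∷ vs) | k
  ...   | yes v′∈ | _     = close P uv ux sx sx′ x′≢x j′ v′∈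
  ...   | no v′∉  | zero  = ⊥-elim (<-asym (subst (c <_) (+-identityʳ _) bound) (∉⇒length< uv v′∉))
  ...   | no v′∉  | suc k =
    walk k (extend x′ j′ P) (∉⇒Unique-∷ v′∉ uv) (∉⇒Unique-∷ x′∉ ux) (sx′ ∷ sx) (subst (c <_) (+-suc _ k) bound)
    where
    x′∉ : x′ ∉ _
    x′∉ x′∈ = v′∉ (All.lookup (path-ends P) x′∈ (joins-sym j′))

  first-cycle : ∀ {x₀} → Selected x₀ → FamilyCycle
  first-cycle {x₀} s₀ =
    walk c (extend x₀ j₀ start) (∉⇒Unique-∷ (λ { (here b≡a) → joins⇒≢ j₀ (sym b≡a) }) ([] ∷ []))
      ([] ∷ []) (s₀ ∷ []) (s≤s (n≤1+n c))
    where
    j₀ : Joins (ε x₀) (proj₁ (edge (ε x₀))) (proj₂ (edge (ε x₀)))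
    j₀ = inj₁ refl

  not-joinedBy : ∀ {es q u w} → q ∉ es → Joins (ε q) u w → ¬ JoinedBy es u w
  not-joinedBy q∉ jq (y , y∈ , jy) = q∉ (subst (_∈ _) (ε-injective (joins-injective jy jq)) y∈)

  -- a chord a–b of the cycle h ∷ cs cuts off the shorter cycle a ∷ mid ++ [b]
  shortcut : ∀ {h cs es q a b} pre mid post → q ∉ es → Joins (ε q) a b →
    Unique (h ∷ cs) → Linked (JoinedBy es) ((h ∷ cs) ++ h ∷ []) →
    h ∷ cs ≡ pre ++ a ∷ mid ++ b ∷ post → 1 ≤ length pre + length post →
    ∃ λ j → 3 ≤ j × j < length (h ∷ cs) × ContainsCycle G j
  shortcut {h} {cs} {es} {q} {a} {b} pre mid post q∉ jq u closed vs≡ outside =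
    length seg , at-least-three , shorter ,
    closed-walk⇒cycle seg-unique
      (Linked-snoc (a ∷ mid) (Linked.map joinedBy⇒adj seg-linked) (ε q , joins-sym jq))
    where
    seg : List (Fin c)
    seg = a ∷ mid ++ b ∷ []
    split : h ∷ cs ≡ pre ++ seg ++ post
    split = trans vs≡ (cong (λ l → pre ++ a ∷ l) (sym (++-assoc mid (b ∷ []) post)))
    seg-linked : Linked (JoinedBy es) seg
    seg-linked = Linked-++⁻ˡ seg (Linked-++⁻ʳ pre (subst (Linked _) split-closed closed))
      where
      split-closed : (h ∷ cs) ++ h ∷ [] ≡ pre ++ seg ++ (post ++ h ∷ [])
      split-closed = trans (cong (_++ h ∷ []) split)
                           (trans (++-assoc pre (seg ++ post) _) (cong (pre ++_) (++-assoc seg post _)))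
    seg-unique : Unique seg
    seg-unique = Unique-++⁻ˡ seg (Unique-++⁻ʳ pre (subst Unique split u))
    mid-nonempty : ∀ mid′ → Linked (JoinedBy es) (a ∷ mid′ ++ b ∷ []) → 1 ≤ length mid′
    mid-nonempty []      (r ∷ _) = contradiction r (not-joinedBy q∉ jq)
    mid-nonempty (_ ∷ _) _       = s≤s z≤n
    at-least-three : 3 ≤ length seg
    at-least-three =
      s≤s (subst (2 ≤_) (sym (length-++ mid)) (+-monoˡ-≤ 1 (mid-nonempty mid seg-linked)))
    shorter : length seg < length (h ∷ cs)
    shorter = begin-strict
      length seg                              <⟨ m<m+n (length seg) outside ⟩
      length seg + (length pre + length post) ≡⟨ x∙yz≈y∙xz (length pre) (length seg) (length post) ⟨
      length pre + (length seg + length post) ≡⟨ cong (length pre +_) (length-++ seg) ⟨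
      length pre + length (seg ++ post)       ≡⟨ length-++ pre ⟨
      length (pre ++ seg ++ post)             ≡⟨ cong length split ⟨
      length (h ∷ cs)                         ∎
      where open ≤-Reasoning

  -- pre and post cannot both be empty, as then b–a would be the closing edge of the cycle
  chord-between : ∀ {h cs es q a b} pre mid post → q ∉ es → Joins (ε q) a b →
    Unique (h ∷ cs) → Linked (JoinedBy es) ((h ∷ cs) ++ h ∷ []) → h ∷ cs ≡ pre ++ a ∷ mid ++ b ∷ post →
    ∃ λ j → 3 ≤ j × j < length (h ∷ cs) × ContainsCycle G j
  chord-between pre@(_ ∷ _) mid post q∉ jq u closed vs≡ = shortcut pre mid post q∉ jq u closed vs≡ (s≤s z≤n)
  chord-between [] mid post@(_ ∷ _) q∉ jq u closed vs≡ = shortcut [] mid post q∉ jq u closed vs≡ (s≤s z≤n)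
  chord-between {a = a} {b} [] mid [] q∉ jq u closed refl =
    contradiction closing-edge (not-joinedBy q∉ (joins-sym jq))
    where
    closing-edge : JoinedBy _ b a
    closing-edge =
      Linked.head (Linked-++⁻ʳ (a ∷ mid) (subst (Linked _) (++-assoc (a ∷ mid) (b ∷ []) (a ∷ [])) closed))

  module _ (C : FamilyCycle) where
    open FamilyCycle C

    chord : ∀ {q} → q ∉ edges → EndsIn (head ∷ rest) q →
      ∃ λ j → 3 ≤ j × j < length (head ∷ rest) × ContainsCycle G j
    chord {q} q∉ q-ends with ∈-∃++ (q-ends (inj₁ refl))
    ... | pre₁ , suf₁ , vs≡ with ∈-++⁻ pre₁ (subst (_ ∈_) vs≡ (q-ends (inj₂ refl)))
    ...   | inj₁ b∈pre with ∈-∃++ b∈pre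
    ...     | pre , mid , pre₁≡ = chord-between pre mid suf₁ q∉ (inj₂ refl) distinct closed
      (trans vs≡ (trans (cong (_++ _ ∷ suf₁) pre₁≡) (++-assoc pre (_ ∷ mid) (_ ∷ suf₁))))
    chord q∉ q-ends | pre₁ , suf₁ , vs≡ | inj₂ (here b≡a) =
      contradiction (sym b≡a) (joins⇒≢ (inj₁ refl))
    chord q∉ q-ends | pre₁ , suf₁ , vs≡ | inj₂ (there b∈suf) with ∈-∃++ b∈suf
    ...     | mid , post , suf≡ = chord-between pre₁ mid post q∉ (inj₁ refl) distinct closed
      (trans vs≡ (cong (λ l → pre₁ ++ _ ∷ l) suf≡))

    -- a cycle through all but one selected edge has that edge as a chord
    cycle-of-allowed-length : ∃ λ j → 3 ≤ j × j ≤ count sel × j + 1 ≢ count sel × ContainsCycle G j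
    cycle-of-allowed-length with length (head ∷ rest) + 1 ℕ.≟ count sel
    ... | no k+1≢m = _ , long , k≤m , k+1≢m , closed-walk⇒cycle distinct (Linked.map joinedBy⇒adj closed)
      where
      k≤m : length (head ∷ rest) ≤ count sel
      k≤m = subst (_≤ count sel) edges-length (length≤count sel edges edges-distinct edges-selected)
    ... | yes k+1≡m with count≡suc-length sel edges edges-distinct edges-selected
                           (trans (sym k+1≡m) (trans (+-comm _ 1) (cong suc (sym edges-length))))
    ...   | q , sq , q∉ , others with chord q∉ q-ends
      where
      q-ends : EndsIn (head ∷ rest) q
      q-ends jq with min-degree-two q sq jq
      ... | x′ , sx′ , x′≢q , _ , j′ = All.lookup edges-ends (others x′ sx′ x′≢q) j′
    ...     | j , 3≤j , j<k , cycle =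
      j , 3≤j , ≤-trans (<⇒≤ j<k) (subst (_ ≤_) k+1≡m (m≤m+n _ 1)) ,
      (λ j+1≡m → <-irrefl (+-cancelʳ-≡ 1 j _ (trans j+1≡m (sym k+1≡m))) j<k) , cycle

  short-cycle : ∀ {x₀} → Selected x₀ →
    ∃ λ j → 3 ≤ j × j ≤ count sel × j + 1 ≢ count sel × ContainsCycle G j
  short-cycle s₀ = cycle-of-allowed-length (first-cycle s₀)

-- The colouring

unique-or-repeated : ∀ {n C : ℕ} (φ : Fin n → Fin C) (S : Subset n) →
  (∃ λ x → x ∈ₛ S × (∀ y → y ∈ₛ S → y ≢ x → φ y ≢ φ x)) ⊎
  (∀ x → x ∈ₛ S → ∃ λ y → y ∈ₛ S × y ≢ x × φ y ≡ φ x)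
unique-or-repeated φ S with FP.any? (λ x → x ∈ₛ? S ×-dec ¬? (twin? x))
  where
  twin? : ∀ x → Dec (∃ λ y → y ∈ₛ S × y ≢ x × φ y ≡ φ x)
  twin? x = FP.any? (λ y → y ∈ₛ? S ×-dec ¬? (y F.≟ x) ×-dec φ y F.≟ φ x)
... | yes (x , x∈ , no-twin) = inj₁ (x , x∈ , λ y y∈ y≢x φy≡φx → no-twin (y , y∈ , y≢x , φy≡φx))
... | no none = inj₂ twin
  where
  twin : ∀ x → x ∈ₛ S → ∃ λ y → y ∈ₛ S × y ≢ x × φ y ≡ φ x
  twin x x∈ with FP.any? (λ y → y ∈ₛ? S ×-dec ¬? (y F.≟ x) ×-dec φ y F.≟ φ x)
  ... | yes t  = t
  ... | no ¬t = contradiction (x , x∈ , ¬t) none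

module CircuitColouring {c k : ℕ} (G : SimpleGraph c (suc k)) (C : Graph.EulerCircuit G)
  {m : ℕ} (S : Subset (suc k)) (facet : IsFCEdge (2 * m) (suc k) S) where
  open Graph G
  open Circuit C
  open ConsecutivePairs (facet-pairs {m = m} S facet)

  ends-of-pair : ∀ {x v w} → Joins (edgeAt x) v w → ∃ λ y → InPair x y × vertexAt y ≡ v
  ends-of-pair {x} j with joins-endpoint (edgeAt-joins x) (joins-sym j)
  ... | inj₁ v≡ = x , inj₁ refl , sym v≡
  ... | inj₂ v≡ = next x , inj₂ refl , sym v≡

  pair-ends : ∀ {x y} → InPair x y → ∃ (Joins (edgeAt x) (vertexAt y))
  pair-ends (inj₁ refl) = _ , edgeAt-joins _
  pair-ends (inj₂ refl) = _ , joins-sym (edgeAt-joins _)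

  in-pair⇒∈ : ∀ {x y} → first x ≡ true → InPair x y → y ∈ₛ S
  in-pair⇒∈ h (inj₁ refl) = proj₁ (first⇒pair _ h)
  in-pair⇒∈ h (inj₂ refl) = proj₂ (first⇒pair _ h)

  -- the two ends of a pair carry the two distinct ends of an edge
  twins-in-different-pairs : ∀ {x y y′} → InPair x y → InPair x y′ → y′ ≢ y → vertexAt y′ ≢ vertexAt y
  twins-in-different-pairs (inj₁ refl) (inj₁ refl) y′≢y _ = y′≢y refl
  twins-in-different-pairs (inj₂ refl) (inj₂ refl) y′≢y _ = y′≢y refl
  twins-in-different-pairs (inj₁ refl) (inj₂ refl) _ e = joins⇒≢ (edgeAt-joins _) (sym e)
  twins-in-different-pairs (inj₂ refl) (inj₁ refl) _ e = joins⇒≢ (edgeAt-joins _) e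

  pair-edges-min-degree-two :
    (∀ y → y ∈ₛ S → ∃ λ y′ → y′ ∈ₛ S × y′ ≢ y × vertexAt y′ ≡ vertexAt y) →
    ∀ x {v w} → first x ≡ true → Joins (edgeAt x) v w →
    ∃ λ x′ → first x′ ≡ true × x′ ≢ x × ∃ (Joins (edgeAt x′) v)
  pair-edges-min-degree-two twins x h j with ends-of-pair j
  ... | y , y-in , refl with twins y (in-pair⇒∈ h y-in)
  ...   | y′ , y′∈ , y′≢y , same with pair-cover y′ y′∈
  ...     | x′ , h′ , y′-in =
    x′ , h′ , (λ { refl → twins-in-different-pairs y-in y′-in y′≢y same }) ,
    subst (λ u → ∃ (Joins (edgeAt x′) u)) same (pair-ends y′-in)

  has-unique-colour : (∀ j → 3 ≤ j → j ≤ m → j + 1 ≢ m → ¬ ContainsCycle G j) → Nonempty S →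
    ∃ λ x → x ∈ₛ S × (∀ y → y ∈ₛ S → y ≢ x → vertexAt y ≢ vertexAt x)
  has-unique-colour no-cycle (y₀ , y₀∈) with unique-or-repeated vertexAt S
  ... | inj₁ found = found
  ... | inj₂ twins with pair-cover y₀ y₀∈
  ...   | x₀ , h₀ , _
    with EdgeFamily.short-cycle G first edgeAt edgeAt-injective (pair-edges-min-degree-two twins) h₀
  ...     | j , 3≤j , j≤ , j+1≢ , cycle =
    ⊥-elim (no-cycle j 3≤j (subst (j ≤_) count-first j≤) (subst (j + 1 ≢_) count-first j+1≢) cycle)

circuit-colouring-CF : ∀ {c n m} (G : SimpleGraph c n) (C : Graph.EulerCircuit G) →
  (∀ j → 3 ≤ j → j ≤ m → j + 1 ≢ m → ¬ ContainsCycle G j) →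
  IsCFColoring (2 * m) n (Graph.Circuit.vertexAt C)
circuit-colouring-CF {n = zero}  G C no-cycle S facet (() , _)
circuit-colouring-CF {n = suc k} {m} G C no-cycle S facet nonempty =
  CircuitColouring.has-unique-colour G C {m = m} S facet no-cycle nonempty

lemma2p9 : (d : ℕ) → Even d → 4 ≤ d →
    (c n : ℕ) (G : SimpleGraph c n) → Eulerian G →
    (∀ j → 3 ≤ j → 2 * j ≤ d → 2 * j + 2 ≢ d → ¬ ContainsCycle G j) →
    ∃ λ (φ : Fin n → Fin c) → IsCFColoring d n φ
lemma2p9 d (m , refl) _ c n G eulerian no-cycle =
  Graph.Circuit.vertexAt C , circuit-colouring-CF G C no-short-cycle
  where
  C : Graph.EulerCircuit G
  C = eulerian⇒eulerCircuit G eulerian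
  no-short-cycle : ∀ j → 3 ≤ j → j ≤ m → j + 1 ≢ m → ¬ ContainsCycle G j
  no-short-cycle j 3≤j j≤m j+1≢m = no-cycle j 3≤j (*-monoʳ-≤ 2 j≤m)
    (λ 2j+2≡2m → j+1≢m (*-cancelˡ-≡ (j + 1) m 2 (trans (*-distribˡ-+ 2 j 1) 2j+2≡2m)))
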